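{- A De Morgan clone $\mathsf C$ with $\mathsf{DMA}\subseteq\mathsf C$ contains a non-harmonious function if and only if it contains $\mathrm{mnh}^2_1$ or $\mathrm{mnh}^2_2$.
   Context: Let $\mathrm{DM}_4=\{\mathsf t,\mathsf f,\mathsf n,\mathsf b\}$. The truth order $\le$ has $\mathsf f$ least, $\mathsf t$ greatest, $\mathsf n,\mathsf b$ incomparable; $\wedge,\vee$ are its meet and join. De Morgan negation: $-\mathsf t=\mathsf f$, $-\mathsf f=\mathsf t$, $-\mathsf n=\mathsf n$, $-\mathsf b=\mathsf b$. Conflation: $\partial\mathsf t=\mathsf t$, $\partial\mathsf f=\mathsf f$, $\partial\mathsf n=\mathsf b$, $\partial\mathsf b=\mathsf n$. A De Morgan function is a map $\mathrm{DM}_4^n\to\mathrm{DM}_4$, $n\ge1$; a De Morgan clone is a set of such functions closed under composition and containing all projections; constants are unary constant functions. $\mathsf{DMA}$ is the clone generated by $\wedge,\vee,\mathsf t,\mathsf f,-$. A function $f$ is harmonious if $f(\partial\overline a)=\partial f(\overline a)$ for all tuples $\overline a$ ($\partial$ applied componentwise). The binary functions $\mathrm{mnh}^2_1,\mathrm{mnh}^2_2$ are given as follows, listing for each first argument $x$ the values at $y=\mathsf t,\mathsf f,\mathsf n,\mathsf b$: $\mathrm{mnh}^2_1$: $x=\mathsf t,\mathsf f,\mathsf b$: $\mathsf f,\mathsf f,\mathsf n,\mathsf b$; $x=\mathsf n$: $\mathsf f,\mathsf f,\mathsf n,\mathsf f$. $\mathrm{mnh}^2_2$: $x=\mathsf t,\mathsf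 f,\mathsf n$: $\mathsf f,\mathsf f,\mathsf n,\mathsf b$; $x=\mathsf b$: $\mathsf f,\mathsf f,\mathsf f,\mathsf b$. -}

module Defs where

open import Data.Nat using (ℕ; suc)
open import Data.Fin using (Fin)
open import Data.Vec using (Vec; []; _∷_; lookup; map; tabulate)
open import Data.Product using (Σ; _×_)
open import Relation.Binary.PropositionalEquality using (_≡_)
open import Relation.Nullary using (¬_)
open import Level using (Level; _⊔_) renaming (suc to lsuc)

data DM4 : Set where
  t f n b : DM4

-- meet in the truth order (f least, t greatest, n and b incomparable)
_∧_ : DM4 → DM4 → DM4
t ∧ y = y
f ∧ y = f
n ∧ t = n
n ∧ f = f
n ∧ n = n
n ∧ b = f
b ∧ t = b
b ∧ f = f
b ∧ n = f
b ∧ b = b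

_∨_ : DM4 → DM4 → DM4
t ∨ y = t
f ∨ y = y
n ∨ t = t
n ∨ f = n
n ∨ n = n
n ∨ b = t
b ∨ t = t
b ∨ f = b
b ∨ n = t
b ∨ b = b

neg : DM4 → DM4
neg t = f
neg f = t
neg n = n
neg b = b

∂ : DM4 → DM4
∂ t = t
∂ f = f
∂ n = b
∂ b = n

-- A De Morgan function of arity k (k ≥ 1); arity is written suc m
DMFun : ℕ → Set
DMFun m = Vec DM4 (suc m) → DM4

proj : ∀ {m} → Fin (suc m) → DMFun m
proj i xs = lookup xs i

compose : ∀ {m k} → DMFun m → Vec (DMFun k) (suc m) → DMFun k
compose F gs xs = F (map (λ g → g xs) gs)

DMSet : (ℓ : Level) → Set (lsuc ℓ)
DMSet ℓ = ∀ {m} → DMFun m → Set ℓ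

-- A De Morgan clone: a set of functions (extensional, i.e. closed under
-- pointwise equality, since functions are sets of input/output pairs)
-- containing all projections and closed under composition.
record IsClone {ℓ} (C : DMSet ℓ) : Set ℓ where
  field
    extensional : ∀ {m} {F G : DMFun m} → (∀ xs → F xs ≡ G xs) → C F → C G
    projections : ∀ {m} (i : Fin (suc m)) → C (proj i)
    composition : ∀ {m k} {F : DMFun m} {gs : Vec (DMFun k) (suc m)} →
                  C F → (∀ i → C (lookup gs i)) → C (compose F gs)

meetF : DMFun 1
meetF (x ∷ y ∷ []) = x ∧ y

joinF : DMFun 1
joinF (x ∷ y ∷ []) = x ∨ y

negF : DMFun 0
negF (x ∷ []) = neg x

constF : DM4 → DMFun 0
constF c _ = c

-- DMA ⊆ C  (for a clone C this is equivalent to containing the generators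
-- of DMA, since DMA is the least clone containing them)
ContainsDMA : ∀ {ℓ} → DMSet ℓ → Set ℓ
ContainsDMA C = C meetF × C joinF × C (constF t) × C (constF f) × C negF

Harmonious : ∀ {m} → DMFun m → Set
Harmonious F = ∀ xs → F (map ∂ xs) ≡ ∂ (F xs)

mnh21 : DMFun 1
mnh21 (n ∷ t ∷ []) = f
mnh21 (n ∷ f ∷ []) = f
mnh21 (n ∷ n ∷ []) = n
mnh21 (n ∷ b ∷ []) = f
mnh21 (_ ∷ t ∷ []) = f
mnh21 (_ ∷ f ∷ []) = f
mnh21 (_ ∷ n ∷ []) = n
mnh21 (_ ∷ b ∷ []) = b

mnh22 : DMFun 1
mnh22 (b ∷ t ∷ []) = f
mnh22 (b ∷ f ∷ []) = f
mnh22 (b ∷ n ∷ []) = f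
mnh22 (b ∷ b ∷ []) = b
mnh22 (_ ∷ t ∷ []) = f
mnh22 (_ ∷ f ∷ []) = f
mnh22 (_ ∷ n ∷ []) = n
mnh22 (_ ∷ b ∷ []) = b

-- Substituting constants for the t- and f-entries of a tuple ā on which F is
-- not harmonious, x for its n-entries and y for its b-entries, yields a binary
-- g ∈ C with g(b,n) ≠ ∂ g(n,b). A value of DM4 is determined by whether it and
-- its negation are designated (∈ {t,b}), so g or −g separates g(n,b) from
-- ∂ g(b,n) by designation. A fixed DMA-context turns such an h into mnh²₁ or
-- mnh²₂, according to which of the two values is the designated one.
module Submission where

open import Defs
open import Data.Bool using (Bool; true; false; if_then_else_) renaming (_≟_ to _≟ᵇ_)
open import Data.Nat using (ℕ; zero; suc)
open import Data.Fin using (zero; suc)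
open import Data.Vec using (Vec; []; _∷_; lookup; map)
open import Data.Vec.Properties using (map-∘; map-cong; map-id)
open import Data.Product using (Σ; ∃; _×_; _,_)
open import Data.Product.Properties using (≡-dec)
open import Data.Sum using (_⊎_; inj₁; inj₂)
open import Relation.Nullary using (¬_; Dec; yes; no; contradiction)
open import Relation.Nullary.Decidable using (map′; ¬?; decidable-stable)
open import Relation.Unary using (Decidable)
open import Relation.Binary.Definitions using (DecidableEquality)
open import Relation.Binary.PropositionalEquality
  using (_≡_; _≢_; refl; sym; trans; cong; cong₂; module ≡-Reasoning)
open import Algebra.Definitions {A = DM4} _≡_ using (_Absorbs_)
open import Function.Bundles using (_⇔_; mk⇔)

nb bn : Vec DM4 2
nb = n ∷ b ∷ []
bn = b ∷ n ∷ []

Searchable : Set → Set₁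
Searchable A = ∀ {P : A → Set} → Decidable P → Dec (∃ P)

searchable-DM4 : Searchable DM4
searchable-DM4 P? with P? t | P? f | P? n | P? b
... | yes p | _     | _     | _     = yes (t , p)
... | no _  | yes p | _     | _     = yes (f , p)
... | no _  | no _  | yes p | _     = yes (n , p)
... | no _  | no _  | no _  | yes p = yes (b , p)
... | no ¬t | no ¬f | no ¬n | no ¬b = no λ
  { (t , p) → ¬t p ; (f , p) → ¬f p ; (n , p) → ¬n p ; (b , p) → ¬b p }

searchable-Vec : ∀ {A} → Searchable A → ∀ k → Searchable (Vec A k)
searchable-Vec search zero P? = map′ ([] ,_) (λ { ([] , p) → p }) (P? [])
searchable-Vec search (suc k) P? =
  map′ (λ { (x , xs , p) → x ∷ xs , p }) (λ { (x ∷ xs , p) → x , xs , p })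
       (search (λ x → searchable-Vec search k (λ xs → P? (x ∷ xs))))

¬∀⇒∃¬ : ∀ {A} → Searchable A → ∀ {P : A → Set} → Decidable P →
        ¬ (∀ x → P x) → ∃ λ x → ¬ P x
¬∀⇒∃¬ search {P} P? ¬∀P with search (λ x → ¬? (P? x))
... | yes witness = witness
... | no ¬∃¬P = contradiction (λ x → decidable-stable (P? x) λ ¬p → ¬∃¬P (x , ¬p)) ¬∀P

∧-absorbs-∨ : _∧_ Absorbs _∨_
∧-absorbs-∨ t y = refl
∧-absorbs-∨ f y = refl
∧-absorbs-∨ n t = refl
∧-absorbs-∨ n f = refl
∧-absorbs-∨ n n = refl
∧-absorbs-∨ n b = refl
∧-absorbs-∨ b t = refl
∧-absorbs-∨ b f = refl
∧-absorbs-∨ b n = refl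
∧-absorbs-∨ b b = refl

∂-involutive : ∀ x → ∂ (∂ x) ≡ x
∂-involutive t = refl
∂-involutive f = refl
∂-involutive n = refl
∂-involutive b = refl

≢∂-sym : ∀ {v w} → w ≢ ∂ v → v ≢ ∂ w
≢∂-sym {v} {w} w≢∂v v≡∂w = w≢∂v (trans (sym (∂-involutive w)) (cong ∂ (sym v≡∂w)))

∂-neg : ∀ x → ∂ (neg x) ≡ neg (∂ x)
∂-neg t = refl
∂-neg f = refl
∂-neg n = refl
∂-neg b = refl

designated : DM4 → Bool
designated t = true
designated f = false
designated n = false
designated b = true

-- Belnap's reading of v as the pair (told true, told false).
told : DM4 → Bool × Bool
told v = designated v , designated (neg v)

fromTold : Bool × Bool → DM4
fromTold (true  , false) = t
fromTold (false , true)  = f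
fromTold (false , false) = n
fromTold (true  , true)  = b

fromTold-told : ∀ v → fromTold (told v) ≡ v
fromTold-told t = refl
fromTold-told f = refl
fromTold-told n = refl
fromTold-told b = refl

told-injective : ∀ {v w} → told v ≡ told w → v ≡ w
told-injective {v} {w} eq = begin
  v                 ≡⟨ sym (fromTold-told v) ⟩
  fromTold (told v) ≡⟨ cong fromTold eq ⟩
  fromTold (told w) ≡⟨ fromTold-told w ⟩
  w                 ∎
  where open ≡-Reasoning

_≟_ : DecidableEquality DM4
v ≟ w = map′ told-injective (cong told) (≡-dec _≟ᵇ_ _≟ᵇ_ (told v) (told w))

separated-by-designation : ∀ {v w} → v ≢ w →
  designated v ≢ designated w ⊎ designated (neg v) ≢ designated (neg w)
separated-by-designation {v} {w} v≢w with designated v ≟ᵇ designated w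
... | no  ≢₁ = inj₁ ≢₁
... | yes ≡₁ = inj₂ λ ≡₂ → v≢w (told-injective (cong₂ _,_ ≡₁ ≡₂))

b∧[n∨v] : ∀ v → b ∧ (n ∨ v) ≡ (if designated v then b else f)
b∧[n∨v] t = refl
b∧[n∨v] f = refl
b∧[n∨v] n = refl
b∧[n∨v] b = refl

n∧[b∨v] : ∀ v → n ∧ (b ∨ v) ≡ (if designated (∂ v) then n else f)
n∧[b∨v] t = refl
n∧[b∨v] f = refl
n∧[b∨v] n = refl
n∧[b∨v] b = refl

-- Equal to y ∧ −y except at (n,b), where it is b or f as h(n,b) is designated
-- or not (b∧[n∨v]), and at (b,n), where it is n or f as ∂ h(b,n) is
-- designated or not (n∧[b∨v]).
mnhOf : DMFun 1 → DMFun 1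
mnhOf h xs@(x ∷ y ∷ []) = (y ∧ neg y) ∧ ((x ∨ neg x) ∨ h xs)

mnhOf≗mnh21 : ∀ h → designated (h nb) ≡ false → designated (∂ (h bn)) ≡ true →
              ∀ xs → mnhOf h xs ≡ mnh21 xs
mnhOf≗mnh21 h d₁ d₂ (t ∷ t ∷ []) = refl
mnhOf≗mnh21 h d₁ d₂ (t ∷ f ∷ []) = refl
mnhOf≗mnh21 h d₁ d₂ (t ∷ n ∷ []) = refl
mnhOf≗mnh21 h d₁ d₂ (t ∷ b ∷ []) = refl
mnhOf≗mnh21 h d₁ d₂ (f ∷ t ∷ []) = refl
mnhOf≗mnh21 h d₁ d₂ (f ∷ f ∷ []) = refl
mnhOf≗mnh21 h d₁ d₂ (f ∷ n ∷ []) = refl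
mnhOf≗mnh21 h d₁ d₂ (f ∷ b ∷ []) = refl
mnhOf≗mnh21 h d₁ d₂ (n ∷ t ∷ []) = refl
mnhOf≗mnh21 h d₁ d₂ (n ∷ f ∷ []) = refl
mnhOf≗mnh21 h d₁ d₂ (n ∷ n ∷ []) = ∧-absorbs-∨ n (h (n ∷ n ∷ []))
mnhOf≗mnh21 h d₁ d₂ (n ∷ b ∷ []) =
  trans (b∧[n∨v] (h nb)) (cong (λ d → if d then b else f) d₁)
mnhOf≗mnh21 h d₁ d₂ (b ∷ t ∷ []) = refl
mnhOf≗mnh21 h d₁ d₂ (b ∷ f ∷ []) = refl
mnhOf≗mnh21 h d₁ d₂ (b ∷ n ∷ []) =
  trans (n∧[b∨v] (h bn)) (cong (λ d → if d then n else f) d₂)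
mnhOf≗mnh21 h d₁ d₂ (b ∷ b ∷ []) = ∧-absorbs-∨ b (h (b ∷ b ∷ []))

mnhOf≗mnh22 : ∀ h → designated (h nb) ≡ true → designated (∂ (h bn)) ≡ false →
              ∀ xs → mnhOf h xs ≡ mnh22 xs
mnhOf≗mnh22 h d₁ d₂ (t ∷ t ∷ []) = refl
mnhOf≗mnh22 h d₁ d₂ (t ∷ f ∷ []) = refl
mnhOf≗mnh22 h d₁ d₂ (t ∷ n ∷ []) = refl
mnhOf≗mnh22 h d₁ d₂ (t ∷ b ∷ []) = refl
mnhOf≗mnh22 h d₁ d₂ (f ∷ t ∷ []) = refl
mnhOf≗mnh22 h d₁ d₂ (f ∷ f ∷ []) = refl
mnhOf≗mnh22 h d₁ d₂ (f ∷ n ∷ []) = refl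
mnhOf≗mnh22 h d₁ d₂ (f ∷ b ∷ []) = refl
mnhOf≗mnh22 h d₁ d₂ (n ∷ t ∷ []) = refl
mnhOf≗mnh22 h d₁ d₂ (n ∷ f ∷ []) = refl
mnhOf≗mnh22 h d₁ d₂ (n ∷ n ∷ []) = ∧-absorbs-∨ n (h (n ∷ n ∷ []))
mnhOf≗mnh22 h d₁ d₂ (n ∷ b ∷ []) =
  trans (b∧[n∨v] (h nb)) (cong (λ d → if d then b else f) d₁)
mnhOf≗mnh22 h d₁ d₂ (b ∷ t ∷ []) = refl
mnhOf≗mnh22 h d₁ d₂ (b ∷ f ∷ []) = refl
mnhOf≗mnh22 h d₁ d₂ (b ∷ n ∷ []) =
  trans (n∧[b∨v] (h bn)) (cong (λ d → if d then n else f) d₂)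
mnhOf≗mnh22 h d₁ d₂ (b ∷ b ∷ []) = ∧-absorbs-∨ b (h (b ∷ b ∷ []))

mnh21-nonharmonious : ¬ Harmonious mnh21
mnh21-nonharmonious harmonious with harmonious nb
... | ()

mnh22-nonharmonious : ¬ Harmonious mnh22
mnh22-nonharmonious harmonious with harmonious nb
... | ()

encode : DM4 → DMFun 1
encode t = λ _ → t
encode f = λ _ → f
encode n = proj zero
encode b = proj (suc zero)

encode-nb : ∀ c → encode c nb ≡ c
encode-nb t = refl
encode-nb f = refl
encode-nb n = refl
encode-nb b = refl

encode-bn : ∀ c → encode c bn ≡ ∂ c
encode-bn t = refl
encode-bn f = refl
encode-bn n = refl
encode-bn b = refl

restrict : ∀ {m} → DMFun m → Vec DM4 (suc m) → DMFun 1
restrict F a = compose F (map encode a)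

restrict-apply : ∀ {m} (F : DMFun m) a xs →
                 restrict F a xs ≡ F (map (λ c → encode c xs) a)
restrict-apply F a xs = cong F (sym (map-∘ (λ g → g xs) encode a))

restrict-nb : ∀ {m} (F : DMFun m) a → restrict F a nb ≡ F a
restrict-nb F a = trans (restrict-apply F a nb)
                        (cong F (trans (map-cong encode-nb a) (map-id a)))

restrict-bn : ∀ {m} (F : DMFun m) a → restrict F a bn ≡ F (map ∂ a)
restrict-bn F a = trans (restrict-apply F a bn) (cong F (map-cong encode-bn a))

module ClosedUnder {ℓ} {C : DMSet ℓ} (clone : IsClone C)
  (meet∈C : C meetF) (join∈C : C joinF) (t∈C : C (constF t))
  (f∈C : C (constF f)) (neg∈C : C negF) where

  open IsClone clone

  compose₁ : ∀ {k} {F : DMFun 0} {g : DMFun k} → C F → C g →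
             C (λ xs → F (g xs ∷ []))
  compose₁ F∈C g∈C = composition F∈C λ { zero → g∈C }

  compose₂ : ∀ {k} {F : DMFun 1} {g h : DMFun k} → C F → C g → C h →
             C (λ xs → F (g xs ∷ h xs ∷ []))
  compose₂ F∈C g∈C h∈C = composition F∈C λ { zero → g∈C ; (suc zero) → h∈C }

  ∧-closed : ∀ {k} {g h : DMFun k} → C g → C h → C (λ xs → g xs ∧ h xs)
  ∧-closed = compose₂ meet∈C

  ∨-closed : ∀ {k} {g h : DMFun k} → C g → C h → C (λ xs → g xs ∨ h xs)
  ∨-closed = compose₂ join∈C

  neg-closed : ∀ {k} {g : DMFun k} → C g → C (λ xs → neg (g xs))
  neg-closed = compose₁ neg∈C

  const-closed : ∀ {k} {c} → C (constF c) → C {k} (λ _ → c)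
  const-closed c∈C = compose₁ c∈C (projections zero)

  encode-closed : ∀ c → C (encode c)
  encode-closed t = const-closed t∈C
  encode-closed f = const-closed f∈C
  encode-closed n = projections zero
  encode-closed b = projections (suc zero)

  restrict-closed : ∀ {m} {F : DMFun m} → C F → ∀ a → C (restrict F a)
  restrict-closed F∈C a = composition F∈C (encodings-closed a)
    where
    encodings-closed : ∀ {j} (a : Vec DM4 j) i → C (lookup (map encode a) i)
    encodings-closed (c ∷ a) zero    = encode-closed c
    encodings-closed (c ∷ a) (suc i) = encodings-closed a i

  mnhOf-closed : ∀ {h} → C h → C (mnhOf h)
  mnhOf-closed h∈C = extensional (λ { (x ∷ y ∷ []) → refl })
    (∧-closed (∧-closed y∈C (neg-closed y∈C))
              (∨-closed (∨-closed x∈C (neg-closed x∈C)) h∈C))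
    where
    x∈C : C {1} (proj zero)
    x∈C = projections zero
    y∈C : C {1} (proj (suc zero))
    y∈C = projections (suc zero)

  mnh-from-separated : ∀ {h} → C h → designated (h nb) ≢ designated (∂ (h bn)) →
                       C mnh21 ⊎ C mnh22
  mnh-from-separated {h} h∈C d≢ with designated (h nb) in d₁ | designated (∂ (h bn)) in d₂
  ... | false | true  = inj₁ (extensional (mnhOf≗mnh21 h d₁ d₂) (mnhOf-closed h∈C))
  ... | true  | false = inj₂ (extensional (mnhOf≗mnh22 h d₁ d₂) (mnhOf-closed h∈C))
  ... | false | false = contradiction refl d≢
  ... | true  | true  = contradiction refl d≢

  mnh-from-binary : ∀ {g} → C g → g bn ≢ ∂ (g nb) → C mnh21 ⊎ C mnh22
  mnh-from-binary {g} g∈C g-nh with separated-by-designation (≢∂-sym g-nh)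
  ... | inj₁ d≢ = mnh-from-separated g∈C d≢
  ... | inj₂ d≢ = mnh-from-separated (neg-closed g∈C)
                    (λ eq → d≢ (trans eq (cong designated (∂-neg (g bn)))))

  mnh-from-nonharmonious : ∀ {m} {F : DMFun m} → C F → ¬ Harmonious F →
                           C mnh21 ⊎ C mnh22
  mnh-from-nonharmonious {m} {F} F∈C F-nh
    with ¬∀⇒∃¬ (searchable-Vec searchable-DM4 (suc m))
               (λ xs → F (map ∂ xs) ≟ ∂ (F xs)) F-nh
  ... | a , a-nh = mnh-from-binary (restrict-closed F∈C a) λ eq → a-nh (begin
    F (map ∂ a)         ≡⟨ sym (restrict-bn F a) ⟩
    restrict F a bn     ≡⟨ eq ⟩
    ∂ (restrict F a nb) ≡⟨ cong ∂ (restrict-nb F a) ⟩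
    ∂ (F a)             ∎)
    where open ≡-Reasoning

mainTheorem8 : ∀ {ℓ} (C : DMSet ℓ) → IsClone C → ContainsDMA C →
    (Σ ℕ (λ m → Σ (DMFun m) (λ F → C F × ¬ Harmonious F))) ⇔ (C mnh21 ⊎ C mnh22)
mainTheorem8 C clone (meet∈C , join∈C , t∈C , f∈C , neg∈C) = mk⇔ forward backward
  where
  open ClosedUnder clone meet∈C join∈C t∈C f∈C neg∈C
  forward : Σ ℕ (λ m → Σ (DMFun m) (λ F → C F × ¬ Harmonious F)) → C mnh21 ⊎ C mnh22
  forward (_ , _ , F∈C , F-nh) = mnh-from-nonharmonious F∈C F-nh
  backward : C mnh21 ⊎ C mnh22 → Σ ℕ (λ m → Σ (DMFun m) (λ F → C F × ¬ Harmonious F))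
  backward (inj₁ mnh21∈C) = 1 , mnh21 , mnh21∈C , mnh21-nonharmonious
  backward (inj₂ mnh22∈C) = 1 , mnh22 , mnh22∈C , mnh22-nonharmonious
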